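{- Let $G$ be a bipartite graph, $H$ a subset of its edges, and $\beta$ a positive integer, with $d_H(v)$ the degree of $v$ in $H$. Call an edge $(u,v)$ full if $(u,v)\in H$ and $d_H(u)+d_H(v)=\beta$, and deficient if $(u,v)\notin H$ and $d_H(u)+d_H(v)=\beta-1$. Let $P=(p_0,p_1,\dots,p_k)$ be a walk in $G$ whose consecutive edges alternate between full and deficient edges (starting with either kind). Then $P$ is a simple path (its vertices are distinct) and its length $k$ is at most $2\beta+1$. -}

module Defs where

open import Data.Nat using (ℕ; zero; suc; _+_; _∸_)
open import Data.Bool using (Bool; true; false; not; if_then_else_)
open import Data.Fin using (Fin; suc; inject₁; toℕ)
open import Data.List using (List; map; allFin)
open import Data.Nat.ListAction using (sum)
open import Data.Product using (Σ; _×_)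
open import Data.Sum using (_⊎_)
open import Relation.Binary.PropositionalEquality using (_≡_; _≢_)

record Graph (n : ℕ) : Set where
  field
    adj    : Fin n → Fin n → Bool
    sym    : ∀ u v → adj u v ≡ adj v u
    irrefl : ∀ v → adj v v ≡ false
open Graph public

IsBipartite : ∀ {n} → Graph n → Set
IsBipartite {n} G =
  Σ (Fin n → Bool) λ c → ∀ u v → adj G u v ≡ true → c u ≢ c v

record EdgeSubset {n : ℕ} (G : Graph n) : Set where
  field
    inH   : Fin n → Fin n → Bool
    symH  : ∀ u v → inH u v ≡ inH v u
    subH  : ∀ u v → inH u v ≡ true → adj G u v ≡ true
open EdgeSubset public

degH : ∀ {n} {G : Graph n} → EdgeSubset G → Fin n → ℕ
degH {n} H v = sum (map (λ u → if inH H v u then 1 else 0) (allFin n))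

Full : ∀ {n} {G : Graph n} → EdgeSubset G → ℕ → Fin n → Fin n → Set
Full H β u v = (inH H u v ≡ true) × (degH H u + degH H v ≡ β)

Deficient : ∀ {n} {G : Graph n} → EdgeSubset G → ℕ → Fin n → Fin n → Set
Deficient {G = G} H β u v =
  (adj G u v ≡ true) × (inH H u v ≡ false) × (degH H u + degH H v ≡ β ∸ 1)

evenℕ : ℕ → Bool
evenℕ zero          = true
evenℕ (suc zero)    = false
evenℕ (suc (suc m)) = evenℕ m

-- A walk p_0 … p_k in G given as p : Fin (suc k) → Fin n; its i-th edge
-- (i : Fin k) joins p (inject₁ i) = p_i and p (suc i) = p_{i+1}.
-- "Alternating between full and deficient edges, starting with either kind":
-- there is a choice fullFirst of the kind of the first edge such that edge i
-- is full when i has the same parity as the first edge's index-kind, and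
-- deficient otherwise.  (Deficient edges carry membership in G; full edges
-- lie in H ⊆ G, so every step is an edge of G.)
ShouldBeFull : Bool → ℕ → Bool
ShouldBeFull true  i = evenℕ i
ShouldBeFull false i = not (evenℕ i)

AlternatingWalk : ∀ {n} {G : Graph n} → EdgeSubset G → ℕ →
                  (k : ℕ) → (Fin (suc k) → Fin n) → Set
AlternatingWalk H β k p =
  Σ Bool λ fullFirst → (i : Fin k) →
    if ShouldBeFull fullFirst (toℕ i)
    then Full H β (p (inject₁ i)) (p (suc i))
    else Deficient H β (p (inject₁ i)) (p (suc i))

-- Along the walk the degrees d_i = d_H(p_i) satisfy d_i + d_{i+1} = β on full
-- edges and β - 1 on deficient ones, so because the edge kinds alternate,
-- d_{i+2} = d_i - 1 after a full edge and d_i + 1 after a deficient one: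
-- along every second vertex the degree moves monotonically, by one per
-- double step.  A repetition p_i = p_j (i < j) forces j - i to be even, since
-- G is bipartite, and then d_j = d_i ∓ (j - i)/2 ≠ d_i.  All degrees lie in
-- [0, β], so at most β double steps fit into the walk: k ≤ 2β + 1.
module Submission where

open import Defs hiding (sym)
open import Data.Nat using (ℕ; zero; suc; _*_; _+_; _∸_; _≤_; _<_; _≤?_; _<?_; z≤n; s≤s)
open import Data.Nat.Properties
open import Data.Nat.Tactic.RingSolver using (solve-∀)
open import Data.Bool using (Bool; true; false; not; if_then_else_)
open import Data.Bool.Properties using (not-involutive; not-¬; ¬-not)
open import Data.Fin using (Fin; zero; suc; inject₁; toℕ; fromℕ<)
open import Data.Fin.Properties using (toℕ-inject₁; toℕ-injective; fromℕ<-toℕ; toℕ-fromℕ<; toℕ<n; toℕ≤pred[n])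
open import Data.Product using (∃-syntax; _×_; _,_; proj₁; proj₂)
open import Data.Empty using (⊥-elim)
open import Function using (_∘_)
open import Function.Definitions using (Injective)
open import Relation.Nullary using (yes; no; contradiction)
open import Relation.Binary using (tri<; tri≈; tri>)
open import Relation.Binary.PropositionalEquality
  using (_≡_; _≢_; refl; sym; trans; cong; subst; subst₂; ≢-sym; module ≡-Reasoning)

open ≡-Reasoning

double-suc : ∀ m i → suc m + suc m + i ≡ 2 + (m + m + i)
double-suc m i = cong (λ x → suc x + i) (+-suc m m)

Alternating : ℕ → (ℕ → Bool) → Set
Alternating k b = ∀ i → i < k → b (suc i) ≡ not (b i)

module _ {k : ℕ} {b : ℕ → Bool} (alt : Alternating k b) where

  alternating-twice : ∀ {i} → 2 + i ≤ k → b (2 + i) ≡ b i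
  alternating-twice {i} le = begin
    b (2 + i)         ≡⟨ alt (suc i) le ⟩
    not (b (suc i))   ≡⟨ cong not (alt i (<⇒≤ le)) ⟩
    not (not (b i))   ≡⟨ not-involutive (b i) ⟩
    b i               ∎

  alternating-even-stride : ∀ m {i} → m + m + i ≤ k → b (m + m + i) ≡ b i
  alternating-even-stride zero    le = refl
  alternating-even-stride (suc m) {i} le = begin
    b (suc m + suc m + i)  ≡⟨ cong b (double-suc m i) ⟩
    b (2 + (m + m + i))    ≡⟨ alternating-twice le′ ⟩
    b (m + m + i)          ≡⟨ alternating-even-stride m (≤-trans (n≤1+n _) (<⇒≤ le′)) ⟩
    b i                    ∎
    where le′ = subst (_≤ k) (double-suc m i) le

  alternating-return-even : ∀ t {i} → t + i ≤ k → b (t + i) ≡ b i → ∃[ m ] t ≡ m + m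
  alternating-return-even zero          _  _  = 0 , refl
  alternating-return-even (suc zero)    le eq = ⊥-elim (not-¬ refl (trans (sym eq) (alt _ le)))
  alternating-return-even (suc (suc t)) le eq
    with alternating-return-even t (≤-trans (n≤1+n _) (<⇒≤ le)) (trans (sym (alternating-twice le)) eq)
  ... | m , refl = suc m , cong suc (sym (+-suc m m))

Drift : Bool → ℕ → ℕ → ℕ → Set
Drift true  m a c = a ≡ m + c
Drift false m a c = c ≡ m + a

drift-zero : ∀ s a → Drift s 0 a a
drift-zero true  a = refl
drift-zero false a = refl

drift-snoc : ∀ s {m a b c} → Drift s m a b → Drift s 1 b c → Drift s (suc m) a c
drift-snoc true  {m} {c = c} a≡m+b b≡1+c = trans a≡m+b (trans (cong (m +_) b≡1+c) (+-suc m c))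
drift-snoc false b≡m+a c≡1+b = trans c≡1+b (cong suc b≡m+a)

drift-≢ : ∀ s {m a c} → Drift s (suc m) a c → a ≢ c
drift-≢ true  {c = c} a≡ a≡c = m≢1+n+m c (trans (sym a≡c) a≡)
drift-≢ false {a = a} c≡ a≡c = m≢1+n+m a (trans a≡c c≡)

drift-≤ : ∀ s {m a c β} → Drift s m a c → a ≤ β → c ≤ β → m ≤ β
drift-≤ true  {m} {c = c} refl a≤β _ = ≤-trans (m≤m+n m c) a≤β
drift-≤ false {m} {a} refl _ c≤β = ≤-trans (m≤m+n m a) c≤β

-- With β = suc γ: the value β, resp. β ∸ 1, of d_H(u) + d_H(v) on a full
-- (true), resp. deficient (false), edge.
degreeSum : ℕ → Bool → ℕ
degreeSum γ true  = suc γ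
degreeSum γ false = γ

degreeSum≤ : ∀ γ s → degreeSum γ s ≤ suc γ
degreeSum≤ γ true  = ≤-refl
degreeSum≤ γ false = n≤1+n γ

consecutive-sums-drift : ∀ γ s {a b c} →
  a + b ≡ degreeSum γ s → b + c ≡ degreeSum γ (not s) → Drift s 1 a c
consecutive-sums-drift γ true {a} {b} {c} ab bc = +-cancelʳ-≡ b a (suc c) (begin
  a + b          ≡⟨ ab ⟩
  suc γ          ≡⟨ cong suc (sym bc) ⟩
  suc (b + c)    ≡⟨ cong suc (+-comm b c) ⟩
  suc c + b      ∎)
consecutive-sums-drift γ false {a} {b} {c} ab bc = +-cancelˡ-≡ b c (suc a) (begin
  b + c          ≡⟨ bc ⟩
  suc γ          ≡⟨ cong suc (sym ab) ⟩
  suc (a + b)    ≡⟨ cong suc (+-comm a b) ⟩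
  suc (b + a)    ≡⟨ sym (+-suc b a) ⟩
  b + suc a      ∎)

module DegreeSequence (γ k : ℕ) (kind : ℕ → Bool) (kind-alt : Alternating k kind)
                      (d : ℕ → ℕ) (sums : ∀ i → i < k → d i + d (suc i) ≡ degreeSum γ (kind i)) where

  degree-bounded : 0 < k → ∀ i → i ≤ k → d i ≤ suc γ
  degree-bounded 0<k zero    _   = ≤-trans (m≤m+n (d 0) (d 1)) (≤-trans (≤-reflexive (sums 0 0<k)) (degreeSum≤ γ _))
  degree-bounded _   (suc i) i<k = ≤-trans (m≤n+m _ (d i)) (≤-trans (≤-reflexive (sums i i<k)) (degreeSum≤ γ _))

  two-step-drift : ∀ {i} → 2 + i ≤ k → Drift (kind i) 1 (d i) (d (2 + i))
  two-step-drift {i} le = consecutive-sums-drift γ (kind i) (sums i (<⇒≤ le))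
    (subst (λ s → d (suc i) + d (2 + i) ≡ degreeSum γ s) (kind-alt i (<⇒≤ le)) (sums (suc i) le))

  stride-drift : ∀ m {i} → m + m + i ≤ k → Drift (kind i) m (d i) (d (m + m + i))
  stride-drift zero    {i} _  = drift-zero (kind i) (d i)
  stride-drift (suc m) {i} le =
    subst (Drift (kind i) (suc m) (d i) ∘ d) (sym (double-suc m i))
      (drift-snoc (kind i) (stride-drift m le″)
        (subst (λ s → Drift s 1 _ _) (alternating-even-stride kind-alt m le″) (two-step-drift le′)))
    where
      le′ : 2 + (m + m + i) ≤ k
      le′ = subst (_≤ k) (double-suc m i) le
      le″ : m + m + i ≤ k
      le″ = ≤-trans (n≤1+n _) (<⇒≤ le′)

module _ {n} {G : Graph n} (H : EdgeSubset G) (γ : ℕ) where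

  Step : Bool → Fin n → Fin n → Set
  Step s u v = adj G u v ≡ true × degH H u + degH H v ≡ degreeSum γ s

  edge-step : ∀ s {u v} → (if s then Full H (suc γ) u v else Deficient H (suc γ) u v) → Step s u v
  edge-step true  (uv∈H , sum)    = subH H _ _ uv∈H , sum
  edge-step false (uv∈G , _ , sum) = uv∈G , sum

  module ℕ-Walk (bip : IsBipartite G) (k : ℕ) (kind : ℕ → Bool) (kind-alt : Alternating k kind)
                (q : ℕ → Fin n) (step : ∀ i → i < k → Step (kind i) (q i) (q (suc i))) where

    colour : ℕ → Bool
    colour = proj₁ bip ∘ q

    colour-alt : Alternating k colour
    colour-alt i i<k = ¬-not (≢-sym (proj₂ bip _ _ (proj₁ (step i i<k))))

    open DegreeSequence γ k kind kind-alt (degH H ∘ q) (λ i i<k → proj₂ (step i i<k))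

    no-return : ∀ t {i} → suc t + i ≤ k → q (suc t + i) ≢ q i
    no-return t le eq with alternating-return-even colour-alt (suc t) le (cong (proj₁ bip) eq)
    ... | suc m , refl = drift-≢ (kind _) (stride-drift (suc m) le) (sym (cong (degH H) eq))

    no-repeat : ∀ {i j} → i < j → j ≤ k → q j ≢ q i
    no-repeat {i} {j} i<j = subst (λ j → j ≤ k → q j ≢ q i) j≡ (no-return (j ∸ suc i))
      where
        j≡ : suc (j ∸ suc i) + i ≡ j
        j≡ = trans (sym (+-suc (j ∸ suc i) i)) (m∸n+n≡m i<j)

    injective : ∀ {i j} → i ≤ k → j ≤ k → q i ≡ q j → i ≡ j
    injective {i} {j} i≤k j≤k eq with <-cmp i j
    ... | tri< i<j _ _ = ⊥-elim (no-repeat i<j j≤k (sym eq))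
    ... | tri≈ _ i≡j _ = i≡j
    ... | tri> _ _ j<i = ⊥-elim (no-repeat j<i i≤k eq)

    length-bound : k ≤ 2 * suc γ + 1
    length-bound with k ≤? 2 * suc γ + 1
    ... | yes k≤ = k≤
    ... | no  k≰ = contradiction
        (drift-≤ (kind 0) (stride-drift (2 + γ) le) (degree-bounded 0<k 0 z≤n) (degree-bounded 0<k _ le))
        (n≮n (suc γ))
      where
        2β+2≡ : ∀ γ → suc (2 * suc γ + 1) ≡ 2 + γ + (2 + γ) + 0
        2β+2≡ = solve-∀
        le : 2 + γ + (2 + γ) + 0 ≤ k
        le = subst (_≤ k) (2β+2≡ γ) (≰⇒> k≰)
        0<k : 0 < k
        0<k = ≤-trans (s≤s z≤n) le

-- Indices beyond k are sent to p zero; only indices i ≤ k are ever used.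
extend : ∀ {A : Set} {k} → (Fin (suc k) → A) → ℕ → A
extend {k = k} p i with i <? suc k
... | yes i<1+k = p (fromℕ< i<1+k)
... | no  _     = p zero

extend-toℕ : ∀ {A : Set} {k} (p : Fin (suc k) → A) (a : Fin (suc k)) → extend p (toℕ a) ≡ p a
extend-toℕ {k = k} p a with toℕ a <? suc k
... | yes a<1+k = cong p (fromℕ<-toℕ a a<1+k)
... | no  a≮1+k = ⊥-elim (a≮1+k (toℕ<n a))

evenℕ-suc : ∀ i → evenℕ (suc i) ≡ not (evenℕ i)
evenℕ-suc zero    = refl
evenℕ-suc (suc i) = trans (sym (not-involutive _)) (cong not (sym (evenℕ-suc i)))

ShouldBeFull-alt : ∀ fullFirst k → Alternating k (ShouldBeFull fullFirst)
ShouldBeFull-alt true  _ i _ = evenℕ-suc i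
ShouldBeFull-alt false _ i _ = cong not (evenℕ-suc i)

walk-steps : ∀ {n} {G : Graph n} (H : EdgeSubset G) γ k (p : Fin (suc k) → Fin n) fullFirst →
  ((i : Fin k) → if ShouldBeFull fullFirst (toℕ i)
                 then Full H (suc γ) (p (inject₁ i)) (p (suc i))
                 else Deficient H (suc γ) (p (inject₁ i)) (p (suc i))) →
  ∀ i → i < k → Step H γ (ShouldBeFull fullFirst i) (extend p i) (extend p (suc i))
walk-steps H γ k p fullFirst edges i i<k =
  subst (λ i → Step H γ (ShouldBeFull fullFirst i) (extend p i) (extend p (suc i))) (toℕ-fromℕ< i<k)
    (subst₂ (Step H γ _) (sym at-i) (sym (extend-toℕ p (suc i′))) (edge-step H γ _ (edges i′)))
  where
    i′ : Fin k
    i′ = fromℕ< i<k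
    at-i : extend p (toℕ i′) ≡ p (inject₁ i′)
    at-i = trans (cong (extend p) (sym (toℕ-inject₁ i′))) (extend-toℕ p (inject₁ i′))

lemma7 : ∀ {n} (G : Graph n) → IsBipartite G → (H : EdgeSubset G) →
         (β : ℕ) → 1 ≤ β →
         (k : ℕ) (p : Fin (suc k) → Fin n) → AlternatingWalk H β k p →
         Injective _≡_ _≡_ p × k ≤ 2 * β + 1
lemma7 G bip H (suc γ) (s≤s z≤n) k p (fullFirst , edges) = p-injective , length-bound
  where
    open ℕ-Walk H γ bip k (ShouldBeFull fullFirst) (ShouldBeFull-alt fullFirst k)
                (extend p) (walk-steps H γ k p fullFirst edges)

    p-injective : Injective _≡_ _≡_ p
    p-injective {a} {b} pa≡pb = toℕ-injective
      (injective (toℕ≤pred[n] a) (toℕ≤pred[n] b)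
        (trans (extend-toℕ p a) (trans pa≡pb (sym (extend-toℕ p b)))))
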